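{- Let $S$ be a factorizable Boolean sublattice and let $\mathcal{C}$ be the set of connected components of the quarkic graph $\mathcal{G}(S)$. Then $S$ is a UFS if and only if $\langle V(C)\rangle$ is a UFS for every $C\in\mathcal{C}$.
   Context: Let $B_{\mathbb{N}}$ be the set of all finite subsets of $\mathbb{N}=\{1,2,3,\dots\}$, ordered by inclusion. A Boolean sublattice is a subset $S\subseteq B_{\mathbb{N}}$ containing $\emptyset$ and closed under finite unions. For a collection $T$ of finite subsets of $\mathbb{N}$, $\langle T\rangle$ denotes the smallest Boolean sublattice containing $T$. A quark of $S$ is a nonempty $A\in S$ such that no $B\in S$ satisfies $\emptyset\subsetneq B\subsetneq A$; $\mathcal{A}(S)$ is the set of quarks. $S$ is factorizable if every nonempty element of $S$ is a union of finitely many quarks. For nonempty $X\in S$, a factorization of $X$ in $S$ is a finite set $z\subseteq\mathcal{A}(S)$ with $\bigcup z=X$ and $\bigcup z'\subsetneq X$ for every proper subset $z'\subsetneq z$. $S$ is a UFS (unique factorization semilattice) if every nonempty $X\in S$ has exactly one factorization in $S$. The quarkic graph $\mathcal{G}(S)$ has vertex set $\mathcal{A}(S)$ and an edge between distinct quarks $A,B$ whenever $A\cap B\neq\emptyset$. -}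

module Defs where

open import Data.Nat using (ℕ)
open import Data.List using (List; []; _++_; concat)
open import Data.List.Membership.Propositional using (_∈_)
open import Data.List.Relation.Binary.Subset.Propositional using (_⊆_)
open import Data.List.Relation.Unary.All using (All)
open import Data.Product using (Σ; ∃; ∃-syntax; _×_; _,_)
open import Relation.Nullary using (¬_)
open import Relation.Binary.Construct.Closure.ReflexiveTransitive using (Star)

-- A finite subset of ℕ = {1,2,...} is represented by a list of its elements
-- (duplicates / order irrelevant); equality of finite sets is extensional.
-- Elements of B_ℕ avoid 0 (paper's ℕ = {1,2,3,...}); see PositiveSet.
FinSet : Set
FinSet = List ℕ

∅ : FinSet
∅ = []

_∪_ : FinSet → FinSet → FinSet
_∪_ = _++_

_≐_ : FinSet → FinSet → Set
X ≐ Y = X ⊆ Y × Y ⊆ X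

_⊊_ : FinSet → FinSet → Set
X ⊊ Y = X ⊆ Y × ¬ (X ≐ Y)

PositiveSet : FinSet → Set
PositiveSet X = ¬ (0 ∈ X)

NonEmpty : FinSet → Set
NonEmpty X = ∃[ n ] (n ∈ X)

Collection : Set₁
Collection = FinSet → Set

-- S ⊆ B_ℕ is a set of sets: membership respects extensional equality
Extensional : Collection → Set
Extensional S = ∀ {X Y} → X ≐ Y → S X → S Y

record BooleanSublattice (S : Collection) : Set where
  field
    extensional : Extensional S
    in-Bℕ       : ∀ {X} → S X → PositiveSet X
    has-∅       : S ∅
    closed-∪    : ∀ {X Y} → S X → S Y → S (X ∪ Y)

-- ⟨T⟩ : smallest Boolean sublattice containing T (inductively generated)
data Gen (T : Collection) : Collection where
  gen-base : ∀ {X} → T X → Gen T X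
  gen-∅    : Gen T ∅
  gen-∪    : ∀ {X Y} → Gen T X → Gen T Y → Gen T (X ∪ Y)
  gen-ext  : ∀ {X Y} → X ≐ Y → Gen T X → Gen T Y

Quark : Collection → FinSet → Set
Quark S A = S A × NonEmpty A × ¬ (∃[ B ] (S B × NonEmpty B × B ⊊ A))

⋃ : List FinSet → FinSet
⋃ = concat

_∈ₛ_ : FinSet → List FinSet → Set
A ∈ₛ z = ∃[ B ] (B ∈ z × A ≐ B)

_⊆ₛ_ : List FinSet → List FinSet → Set
z ⊆ₛ w = ∀ {A} → A ∈ z → A ∈ₛ w

_≈ₛ_ : List FinSet → List FinSet → Set
z ≈ₛ w = z ⊆ₛ w × w ⊆ₛ z

_⊊ₛ_ : List FinSet → List FinSet → Set
z ⊊ₛ w = z ⊆ₛ w × ¬ (w ⊆ₛ z)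

Factorizable : Collection → Set
Factorizable S = ∀ X → S X → NonEmpty X →
  ∃[ z ] (All (Quark S) z × ⋃ z ≐ X)

IsFactorization : Collection → FinSet → List FinSet → Set
IsFactorization S X z =
  All (Quark S) z × ⋃ z ≐ X × (∀ z' → z' ⊊ₛ z → ⋃ z' ⊊ X)

UFS : Collection → Set
UFS S = ∀ X → S X → NonEmpty X →
  ∃[ z ] (IsFactorization S X z) ×
  (∀ z₁ z₂ → IsFactorization S X z₁ → IsFactorization S X z₂ → z₁ ≈ₛ z₂)

Adj : Collection → FinSet → FinSet → Set
Adj S A B = Quark S A × Quark S B × ¬ (A ≐ B) × ∃[ n ] (n ∈ A × n ∈ B)

-- vertex set V(C) of the connected component C of G(S) containing quark Q
Component : Collection → FinSet → Collection
Component S Q A = Quark S A × Star (Adj S) Q A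

{-# OPTIONS --safe #-}
-- Any cover of X by quarks can be thinned out to a factorization of X.  Quarks of the
-- sublattice generated by a set T of quarks of S are (up to equality) members of T, so
-- factorizations in ⟨T⟩ are factorizations in S, which gives the forward direction.
-- Conversely, given factorizations z₁, z₂ of X in S and a quark A ∈ z₁, let U be the union
-- of the members of z₁ ∪ z₂ reachable from A through nonempty intersections.  The members
-- of zᵢ meeting U lie inside U and in the component of A, so they form two factorizations
-- of X ∩ U in ⟨V(C_A)⟩; by uniqueness there, A occurs in z₂.
module Submission where

open import Defs
open import Function.Base using (id; _∘_; _on_)
open import Function.Bundles using (_⇔_; mk⇔)
open import Data.Nat using (_<_)
open import Data.Nat.Properties using (_≟_)
open import Data.Nat.Induction using (<-wellFounded)
open import Data.List using (List; []; _∷_; _++_; filter; length)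
open import Data.List.Properties using (concat-++; ++-identityʳ; filter-notAll)
open import Data.List.Membership.Propositional using (_∈_; find; lose)
open import Data.List.Membership.Propositional.Properties
  using (∈-concat⁺′; ∈-concat⁻′; ∈-filter⁺; ∈-filter⁻; ∈-++⁺ˡ; ∈-++⁺ʳ; ∈-++⁻)
open import Data.List.Membership.DecPropositional _≟_ using (_∈?_)
open import Data.List.Relation.Binary.Subset.Propositional using (_⊆_)
open import Data.List.Relation.Binary.Subset.Propositional.Properties
  using (⊆-reflexive; ⊆-trans; Any-resp-⊆; xs⊆ys++xs; filter-⊆)
  renaming (++⁺ to ++-mono-⊆)
open import Data.List.Relation.Binary.Subset.DecPropositional _≟_ using (_⊆?_)
open import Data.List.Relation.Unary.Any as Any using (Any; any?)
open import Data.List.Relation.Unary.All as All using (All; []; _∷_; all?)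
open import Data.List.Relation.Unary.All.Properties using (¬All⇒Any¬)
  renaming (++⁺ to All-++⁺; filter⁺ to All-filter⁺)
open import Data.Product using (∃-syntax; _×_; _,_; proj₁; proj₂)
open import Data.Sum using (_⊎_; inj₁; inj₂; [_,_]′)
open import Data.Empty using (⊥-elim)
open import Relation.Nullary using (¬_; Dec; yes; no; ¬?)
open import Relation.Nullary.Decidable using (_×-dec_; map′)
open import Relation.Unary using (Decidable)
open import Relation.Binary.PropositionalEquality using (refl; sym)
open import Relation.Binary.Construct.Closure.ReflexiveTransitive using (ε; _◅_; _◅◅_)
import Relation.Binary.Construct.On as On
open import Induction.WellFounded using (WellFounded; Acc; acc)

private
  variable
    A B D E U X Y Z : FinSet
    L w z z₁ z₂ : List FinSet
    S T : Collection

≐-refl : X ≐ X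
≐-refl = id , id

≐-sym : X ≐ Y → Y ≐ X
≐-sym (p , q) = q , p

≐-trans : X ≐ Y → Y ≐ Z → X ≐ Z
≐-trans (p , q) (r , s) = ⊆-trans p r , ⊆-trans s q

_≐?_ : (X Y : FinSet) → Dec (X ≐ Y)
X ≐? Y = (X ⊆? Y) ×-dec (Y ⊆? X)

⊆-⋃ : A ∈ z → A ⊆ ⋃ z
⊆-⋃ A∈z x∈A = ∈-concat⁺′ x∈A A∈z

∈-⋃⁻ : ∀ {x} z → x ∈ ⋃ z → ∃[ A ] (x ∈ A × A ∈ z)
∈-⋃⁻ = ∈-concat⁻′

⋃-mono : z ⊆ₛ w → ⋃ z ⊆ ⋃ w
⋃-mono {z} z⊆w x∈⋃z with ∈-⋃⁻ z x∈⋃z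
... | A , x∈A , A∈z with z⊆w A∈z
...   | B , B∈w , A≐B = ⊆-⋃ B∈w (proj₁ A≐B x∈A)

⋃-++ : ∀ z w → ⋃ (z ++ w) ≐ (⋃ z ∪ ⋃ w)
⋃-++ z w = ⊆-reflexive (sym (concat-++ z w)) , ⊆-reflexive (concat-++ z w)

⋃-filter-split : ∀ {P : FinSet → Set} (P? : Decidable P) z →
  ⋃ z ⊆ (⋃ (filter P? z) ∪ ⋃ (filter (¬? ∘ P?) z))
⋃-filter-split P? z x∈⋃z with ∈-⋃⁻ z x∈⋃z
... | A , x∈A , A∈z with P? A
...   | yes PA = ∈-++⁺ˡ (⊆-⋃ (∈-filter⁺ P? A∈z PA) x∈A)
...   | no ¬PA = ∈-++⁺ʳ _ (⊆-⋃ (∈-filter⁺ (¬? ∘ P?) A∈z ¬PA) x∈A)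

⊆⇒⊆ₛ : z ⊆ w → z ⊆ₛ w
⊆⇒⊆ₛ z⊆w A∈z = _ , z⊆w A∈z , ≐-refl

∈ₛ-⊆ : z ⊆ w → A ∈ₛ z → A ∈ₛ w
∈ₛ-⊆ z⊆w (B , B∈z , A≐B) = B , z⊆w B∈z , A≐B

_∈ₛ?_ : ∀ A w → Dec (A ∈ₛ w)
A ∈ₛ? w = map′ find (λ (_ , B∈w , A≐B) → lose B∈w A≐B) (any? (A ≐?_) w)

⊈ₛ⇒∉ₛ : ¬ (z ⊆ₛ w) → ∃[ A ] (A ∈ z × ¬ (A ∈ₛ w))
⊈ₛ⇒∉ₛ {z} {w} z⊈w with all? (_∈ₛ? w) z
... | yes z⊆w = ⊥-elim (z⊈w (All.lookup z⊆w))
... | no ¬z⊆w = find (¬All⇒Any¬ (_∈ₛ? w) z ¬z⊆w)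

Shorter : List FinSet → List FinSet → Set
Shorter = _<_ on length

Shorter-wellFounded : WellFounded Shorter
Shorter-wellFounded = On.wellFounded length <-wellFounded

filter-shrinks : ∀ {P : FinSet → Set} (P? : Decidable P) →
  Any (¬_ ∘ P) z → Shorter (filter P? z) z
filter-shrinks P? = filter-notAll P? _

Gen-least : BooleanSublattice S → (∀ {X} → T X → S X) → Gen T X → S X
Gen-least BS T⊆S (gen-base t) = T⊆S t
Gen-least BS T⊆S gen-∅ = BooleanSublattice.has-∅ BS
Gen-least BS T⊆S (gen-∪ g h) = BooleanSublattice.closed-∪ BS (Gen-least BS T⊆S g) (Gen-least BS T⊆S h)
Gen-least BS T⊆S (gen-ext X≐Y g) = BooleanSublattice.extensional BS X≐Y (Gen-least BS T⊆S g)

Gen⇒⋃ : Gen T X → ∃[ z ] (All T z × ⋃ z ≐ X)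
Gen⇒⋃ (gen-base {X} t) = X ∷ [] , t ∷ [] , ⊆-reflexive (++-identityʳ X) , ⊆-reflexive (sym (++-identityʳ X))
Gen⇒⋃ gen-∅ = [] , [] , ≐-refl
Gen⇒⋃ (gen-∪ g h) with Gen⇒⋃ g | Gen⇒⋃ h
... | z , tz , (p , q) | w , tw , (r , s) =
  z ++ w , All-++⁺ tz tw , ≐-trans (⋃-++ z w) (++-mono-⊆ p r , ++-mono-⊆ q s)
Gen⇒⋃ (gen-ext X≐Y g) with Gen⇒⋃ g
... | z , tz , ⋃z≐X = z , tz , ≐-trans ⋃z≐X X≐Y

⋃⇒Gen : All (Gen T) z → Gen T (⋃ z)
⋃⇒Gen [] = gen-∅
⋃⇒Gen (g ∷ gs) = gen-∪ g (⋃⇒Gen gs)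

Quark-resp-≐ : Extensional S → A ≐ B → Quark S A → Quark S B
Quark-resp-≐ ext A≐B (sA , (n , n∈A) , minimal) =
  ext A≐B sA , (n , proj₁ A≐B n∈A) ,
  λ (C , sC , neC , C⊆B , C≉B) →
    minimal (C , sC , neC , ⊆-trans C⊆B (proj₂ A≐B) , λ C≐A → C≉B (≐-trans C≐A A≐B))

Quark-restrict : ∀ {S′} → (∀ {X} → S′ X → S X) → S′ A → Quark S A → Quark S′ A
Quark-restrict S′⊆S s′A (_ , neA , minimal) =
  s′A , neA , λ (B , s′B , rest) → minimal (B , S′⊆S s′B , rest)

Quark-Gen⇒generator : Quark (Gen T) B → ∃[ A ] (T A × A ≐ B)
Quark-Gen⇒generator {B = B} (gB , (n , n∈B) , minimal) with Gen⇒⋃ gB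
... | z , tz , (⋃z⊆B , B⊆⋃z) with ∈-⋃⁻ z (B⊆⋃z n∈B)
...   | A , n∈A , A∈z with A ≐? B
...     | yes A≐B = A , All.lookup tz A∈z , A≐B
...     | no A≉B = ⊥-elim (minimal (A , gen-base (All.lookup tz A∈z) , (n , n∈A) ,
                                    ⊆-trans (⊆-⋃ A∈z) ⋃z⊆B , A≉B))

Irredundant : FinSet → List FinSet → Set
Irredundant X z = ∀ z′ → z′ ⊊ₛ z → ⋃ z′ ⊊ X

Irredundant-resp-≐ : X ≐ Y → Irredundant X z → Irredundant Y z
Irredundant-resp-≐ X≐Y irr z′ z′⊊z with irr z′ z′⊊z
... | ⋃z′⊆X , ⋃z′≉X = ⊆-trans ⋃z′⊆X (proj₁ X≐Y) , λ ⋃z′≐Y → ⋃z′≉X (≐-trans ⋃z′≐Y (≐-sym X≐Y))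

IsFactorization-resp-≐ : X ≐ Y → IsFactorization S X z → IsFactorization S Y z
IsFactorization-resp-≐ X≐Y (qz , ⋃z≐X , irr) = qz , ≐-trans ⋃z≐X X≐Y , Irredundant-resp-≐ X≐Y irr

UFS-unique : UFS S → S X → NonEmpty X → IsFactorization S X z₁ → IsFactorization S X z₂ → z₁ ≈ₛ z₂
UFS-unique ufs sX neX = proj₂ (proj₂ (ufs _ sX neX)) _ _

remove : FinSet → List FinSet → List FinSet
remove A = filter (λ B → ¬? (B ≐? A))

remove-⊆ₛ : ∀ A z → remove A z ⊆ₛ z
remove-⊆ₛ A z = ⊆⇒⊆ₛ (filter-⊆ _ z)

⊆ₛ-remove : z ⊆ₛ w → ¬ (A ∈ₛ z) → z ⊆ₛ remove A w
⊆ₛ-remove {A = A} z⊆w A∉z B∈z with z⊆w B∈z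
... | C , C∈w , B≐C with C ≐? A
...   | yes C≐A = ⊥-elim (A∉z (_ , B∈z , ≐-sym (≐-trans B≐C C≐A)))
...   | no C≉A = C , ∈-filter⁺ (λ D → ¬? (D ≐? A)) C∈w C≉A , B≐C

remove-shrinks : A ∈ z → Shorter (remove A z) z
remove-shrinks = filter-shrinks _ ∘ Any.map (λ { refl A≉A → A≉A ≐-refl })

Redundant : FinSet → List FinSet → FinSet → Set
Redundant X z A = X ⊆ ⋃ (remove A z)

redundant? : ∀ X z → Decidable (Redundant X z)
redundant? X z A = X ⊆? ⋃ (remove A z)

irreducible⇒Irredundant : ⋃ z ≐ X → (∀ {A} → A ∈ z → ¬ Redundant X z A) → Irredundant X z
irreducible⇒Irredundant ⋃z≐X irreducible z′ (z′⊆z , z⊈z′) with ⊈ₛ⇒∉ₛ z⊈z′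
... | A , A∈z , A∉z′ =
  ⊆-trans (⋃-mono z′⊆z) (proj₁ ⋃z≐X) ,
  λ ⋃z′≐X → irreducible A∈z (⊆-trans (proj₂ ⋃z′≐X) (⋃-mono (⊆ₛ-remove z′⊆z A∉z′)))

irredundant-subcover : ∀ {P : FinSet → Set} w → All P w → ⋃ w ≐ X →
  ∃[ z ] (All P z × ⋃ z ≐ X × Irredundant X z)
irredundant-subcover w = go w (Shorter-wellFounded w)
  where
  go : ∀ {P X} w → Acc Shorter w → All P w → ⋃ w ≐ X → ∃[ z ] (All P z × ⋃ z ≐ X × Irredundant X z)
  go {X = X} w (acc rs) pw ⋃w≐X with any? (redundant? X w) w
  ... | no none = w , pw , ⋃w≐X , irreducible⇒Irredundant ⋃w≐X (λ A∈w r → none (lose A∈w r))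
  ... | yes some with find some
  ...   | A , A∈w , X⊆rest =
    go (remove A w) (rs (remove-shrinks A∈w)) (All-filter⁺ _ pw)
       (⊆-trans (⋃-mono (remove-⊆ₛ A w)) (proj₁ ⋃w≐X) , X⊆rest)

Irredundant-filter : ∀ {P : FinSet → Set} (P? : Decidable P) → (∀ {A B} → A ⊆ B → P A → P B) →
  ⋃ z ≐ X → Irredundant X z → Irredundant (⋃ (filter P? z)) (filter P? z)
Irredundant-filter {z = z} {X = X} {P = P} P? P-mono (⋃z⊆X , X⊆⋃z) irr z′ (z′⊆kept , kept⊈z′) =
  ⋃-mono z′⊆kept ,
  λ ⋃z′≐⋃kept → proj₂ (irr (z′ ++ dropped) (z′++dropped⊆z , z⊈z′++dropped))
                       (⊆-trans (⋃-mono z′++dropped⊆z) ⋃z⊆X , X⊆⋃z′++dropped ⋃z′≐⋃kept)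
  where
  dropped : List FinSet
  dropped = filter (¬? ∘ P?) z
  z′++dropped⊆z : (z′ ++ dropped) ⊆ₛ z
  z′++dropped⊆z B∈ with ∈-++⁻ z′ B∈
  ... | inj₁ B∈z′ with z′⊆kept B∈z′
  ...   | C , C∈kept , B≐C = C , proj₁ (∈-filter⁻ P? C∈kept) , B≐C
  z′++dropped⊆z B∈ | inj₂ B∈dropped = ⊆⇒⊆ₛ (filter-⊆ (¬? ∘ P?) z) B∈dropped
  z⊈z′++dropped : ¬ (z ⊆ₛ (z′ ++ dropped))
  z⊈z′++dropped z⊆ = kept⊈z′ λ D∈kept → inz′ (∈-filter⁻ P? D∈kept)
    where
    inz′ : D ∈ z × P D → D ∈ₛ z′
    inz′ (D∈z , PD) with z⊆ D∈z
    ... | B , B∈ , D≐B with ∈-++⁻ z′ B∈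
    ...   | inj₁ B∈z′ = B , B∈z′ , D≐B
    ...   | inj₂ B∈dropped = ⊥-elim (proj₂ (∈-filter⁻ (¬? ∘ P?) {xs = z} B∈dropped) (P-mono (proj₁ D≐B) PD))
  X⊆⋃z′++dropped : ⋃ z′ ≐ ⋃ (filter P? z) → X ⊆ ⋃ (z′ ++ dropped)
  X⊆⋃z′++dropped (_ , ⋃kept⊆⋃z′) =
    ⊆-trans X⊆⋃z (⊆-trans (⋃-filter-split P? z)
      (⊆-trans (++-mono-⊆ ⋃kept⊆⋃z′ id) (proj₂ (⋃-++ z′ dropped))))

Meets : FinSet → FinSet → Set
Meets D U = Any (_∈ U) D

meets? : ∀ U → Decidable (λ D → Meets D U)
meets? U D = any? (_∈? U) D

Meets-⋃⁻ : ∀ w → Meets D (⋃ w) → ∃[ E ] (E ∈ w × Meets D E)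
Meets-⋃⁻ w m with find m
... | x , x∈D , x∈⋃w with ∈-⋃⁻ w x∈⋃w
...   | E , x∈E , E∈w = E , E∈w , lose x∈D x∈E

⋃-meeting-mono : ∀ z w → ⋃ z ⊆ ⋃ w → (∀ {D} → D ∈ z → Meets D U → D ⊆ U) →
  ⋃ (filter (meets? U) z) ⊆ ⋃ (filter (meets? U) w)
⋃-meeting-mono {U} z w ⋃z⊆⋃w swallowed x∈ with ∈-⋃⁻ (filter (meets? U) z) x∈
... | D , x∈D , D∈ with ∈-filter⁻ (meets? U) D∈
...   | D∈z , D-meets with ∈-⋃⁻ w (⋃z⊆⋃w (⊆-⋃ D∈z x∈D))
...     | E , x∈E , E∈w =
  ⊆-⋃ (∈-filter⁺ (meets? U) E∈w (lose x∈E (swallowed D∈z D-meets x∈D))) x∈E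

Saturated : List FinSet → List FinSet → Set
Saturated L W = ∀ {D} → D ∈ L → Meets D (⋃ W) → D ∈ W

-- Worklist closure: members of R meeting ⋃ W are moved into W until none is left.
module _ {P Q : FinSet → Set} (spread : ∀ {E D} → P E → Q D → Meets D E → P D) (L : List FinSet) where

  saturate : ∀ {W} R → Acc Shorter R → All P W → All Q R → (∀ {D} → D ∈ L → D ∈ W ⊎ D ∈ R) →
    ∃[ W′ ] (All P W′ × W ⊆ W′ × Saturated L W′)
  saturate {W} R (acc rs) pW qR L⊆W∪R with any? (meets? (⋃ W)) R
  ... | no none =
    W , pW , id , λ D∈L D-meets → [ id , (λ D∈R → ⊥-elim (none (lose D∈R D-meets))) ]′ (L⊆W∪R D∈L)
  ... | yes some with saturate (filter (¬? ∘ meets? (⋃ W)) R) (rs (filter-shrinks _ (Any.map (λ m ¬m → ¬m m) some)))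
                               (All-++⁺ p-meeting pW) (All-filter⁺ _ qR) L⊆W′∪R′
    where
    meeting : List FinSet
    meeting = filter (meets? (⋃ W)) R
    p-meeting : All P meeting
    p-meeting = All.tabulate λ D∈ →
      let D∈R , D-meets = ∈-filter⁻ (meets? (⋃ W)) D∈
          E , E∈W , D-meets-E = Meets-⋃⁻ W D-meets
      in spread (All.lookup pW E∈W) (All.lookup qR D∈R) D-meets-E
    L⊆W′∪R′ : ∀ {D} → D ∈ L → D ∈ meeting ++ W ⊎ D ∈ filter (¬? ∘ meets? (⋃ W)) R
    L⊆W′∪R′ D∈L with L⊆W∪R D∈L
    ... | inj₁ D∈W = inj₁ (∈-++⁺ʳ meeting D∈W)
    ... | inj₂ D∈R with meets? (⋃ W) _
    ...   | yes m = inj₁ (∈-++⁺ˡ (∈-filter⁺ (meets? (⋃ W)) D∈R m))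
    ...   | no ¬m = inj₂ (∈-filter⁺ (¬? ∘ meets? (⋃ W)) D∈R ¬m)
  ... | W′ , pW′ , W″⊆W′ , saturated = W′ , pW′ , W″⊆W′ ∘ xs⊆ys++xs _ _ , saturated

module _ (S : Collection) (BS : BooleanSublattice S) where
  open BooleanSublattice BS using (extensional)

  Gen-quarks⊆S : (∀ {A} → T A → Quark S A) → Gen T X → S X
  Gen-quarks⊆S T⊆quarks = Gen-least BS (proj₁ ∘ T⊆quarks)

  generator-Quark-Gen : (∀ {A} → T A → Quark S A) → T A → Quark (Gen T) A
  generator-Quark-Gen T⊆quarks tA = Quark-restrict (Gen-quarks⊆S T⊆quarks) (gen-base tA) (T⊆quarks tA)

  Quark-Gen⇒Quark : (∀ {A} → T A → Quark S A) → Quark (Gen T) B → Quark S B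
  Quark-Gen⇒Quark T⊆quarks qB with Quark-Gen⇒generator qB
  ... | A , tA , A≐B = Quark-resp-≐ extensional A≐B (T⊆quarks tA)

  UFS-Gen : (∀ {A} → T A → Quark S A) → UFS S → UFS (Gen T)
  UFS-Gen {T} T⊆quarks ufs X gX neX with Gen⇒⋃ gX
  ... | z , tz , ⋃z≐X with irredundant-subcover z (All.map (generator-Quark-Gen T⊆quarks) tz) ⋃z≐X
  ...   | z′ , factorization =
    z′ , factorization ,
    λ _ _ f₁ f₂ → UFS-unique ufs (Gen-quarks⊆S T⊆quarks gX) neX (inS f₁) (inS f₂)
    where
    inS : ∀ {w} → IsFactorization (Gen T) X w → IsFactorization S X w
    inS (qw , ⋃w≐X , irr) = All.map (Quark-Gen⇒Quark T⊆quarks) qw , ⋃w≐X , irr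

  module _ {Q : FinSet} where
    private
      G = Gen (Component S Q)

    component-Quark-Gen : Component S Q A → Quark G A
    component-Quark-Gen = generator-Quark-Gen proj₁

    Quark-Gen-spread : Quark G E → Quark S D → Meets D E → Quark G D
    Quark-Gen-spread {D = D} qE qD D-meets-E with Quark-Gen⇒generator qE
    ... | E′ , (qE′ , Q⇝E′) , E′≐E with D ≐? E′ | find (Any.map (proj₂ E′≐E) D-meets-E)
    ...   | yes D≐E′ | _ = Quark-resp-≐ gen-ext (≐-sym D≐E′) (component-Quark-Gen (qE′ , Q⇝E′))
    ...   | no D≉E′ | n , n∈D , n∈E′ =
      component-Quark-Gen (qD , Q⇝E′ ◅◅ ((qE′ , qD , D≉E′ ∘ ≐-sym , n , n∈E′ , n∈D) ◅ ε))

  component-hull : Quark S A → All (Quark S) L →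
    ∃[ U ] (A ⊆ U × ∀ {D} → D ∈ L → Meets D U → D ⊆ U × Quark (Gen (Component S A)) D)
  component-hull {A} {L} qA qL with saturate Quark-Gen-spread L L (Shorter-wellFounded L)
                                        (component-Quark-Gen (qA , ε) ∷ []) qL inj₂
  ... | W , qW , A∈W , saturated =
    ⋃ W , ⊆-⋃ (A∈W (Any.here refl)) ,
    λ D∈L D-meets → ⊆-⋃ (saturated D∈L D-meets) , All.lookup qW (saturated D∈L D-meets)

  restrict-factorization : ∀ {G} U → (∀ {D} → D ∈ z → Meets D U → Quark G D) →
    IsFactorization S X z → IsFactorization G (⋃ (filter (meets? U) z)) (filter (meets? U) z)
  restrict-factorization U quark (_ , ⋃z≐X , irr) =
    All.tabulate (λ D∈ → let D∈z , D-meets = ∈-filter⁻ (meets? U) D∈ in quark D∈z D-meets) ,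
    ≐-refl ,
    Irredundant-filter (meets? U) Any-resp-⊆ ⋃z≐X irr

  ComponentsUFS : Set
  ComponentsUFS = ∀ Q → Quark S Q → UFS (Gen (Component S Q))

  factorization-⊆ₛ : ComponentsUFS → IsFactorization S X z₁ → IsFactorization S X z₂ → z₁ ⊆ₛ z₂
  factorization-⊆ₛ {X} {z₁} {z₂} ufs f₁@(q₁ , ⋃z₁≐X , _) f₂@(q₂ , ⋃z₂≐X , _) {A} A∈z₁
    with All.lookup q₁ A∈z₁
  ... | qA@(_ , (n , n∈A) , _) with component-hull qA (All-++⁺ q₁ q₂)
  ...   | U , A⊆U , hull = ∈ₛ-⊆ (filter-⊆ (meets? U) z₂) A∈ₛz₂′
    where
    G : Collection
    G = Gen (Component S A)
    hull₁ : ∀ {D} → D ∈ z₁ → Meets D U → D ⊆ U × Quark G D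
    hull₁ D∈z₁ = hull (∈-++⁺ˡ D∈z₁)
    hull₂ : ∀ {D} → D ∈ z₂ → Meets D U → D ⊆ U × Quark G D
    hull₂ D∈z₂ = hull (∈-++⁺ʳ z₁ D∈z₂)
    F₁ : IsFactorization G (⋃ (filter (meets? U) z₁)) (filter (meets? U) z₁)
    F₁ = restrict-factorization U (λ D∈ → proj₂ ∘ hull₁ D∈) f₁
    F₂ : IsFactorization G (⋃ (filter (meets? U) z₂)) (filter (meets? U) z₂)
    F₂ = restrict-factorization U (λ D∈ → proj₂ ∘ hull₂ D∈) f₂
    same-union : ⋃ (filter (meets? U) z₂) ≐ ⋃ (filter (meets? U) z₁)
    same-union = ⋃-meeting-mono z₂ z₁ (⊆-trans (proj₁ ⋃z₂≐X) (proj₂ ⋃z₁≐X)) (λ D∈ → proj₁ ∘ hull₂ D∈) ,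
                 ⋃-meeting-mono z₁ z₂ (⊆-trans (proj₁ ⋃z₁≐X) (proj₂ ⋃z₂≐X)) (λ D∈ → proj₁ ∘ hull₁ D∈)
    A∈z₁′ : A ∈ filter (meets? U) z₁
    A∈z₁′ = ∈-filter⁺ (meets? U) A∈z₁ (lose n∈A (A⊆U n∈A))
    A∈ₛz₂′ : A ∈ₛ filter (meets? U) z₂
    A∈ₛz₂′ = proj₁ (UFS-unique (ufs A qA) (⋃⇒Gen (All.map proj₁ (proj₁ F₁))) (n , ⊆-⋃ A∈z₁′ n∈A)
                      F₁ (IsFactorization-resp-≐ same-union F₂)) A∈z₁′

  UFS-from-components : Factorizable S → ComponentsUFS → UFS S
  UFS-from-components factorizable ufs X sX neX =
    let z , qz , ⋃z≐X = factorizable X sX neX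
        z′ , factorization = irredundant-subcover z qz ⋃z≐X
    in z′ , factorization ,
    λ z₁ z₂ f₁ f₂ → factorization-⊆ₛ ufs f₁ f₂ , factorization-⊆ₛ ufs f₂ f₁

proposition4p1 : (S : Collection) → BooleanSublattice S → Factorizable S →
    (UFS S ⇔ (∀ Q → Quark S Q → UFS (Gen (Component S Q))))
proposition4p1 S BS factorizable =
  mk⇔ (λ ufs _ _ → UFS-Gen S BS proj₁ ufs) (UFS-from-components S BS factorizable)
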